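{- Let $Z=Z(V_R\cup V_B)$ be a $d$-dimensional symmetric $\Pi$-zonotope with $V_R\cup V_B\subseteq V(d)$ whose graph $G_Z$ (on $d+1$ vertices) is connected, with red subgraph $G_R$ and blue subgraph $G_B$ (spanning subgraphs on all $d+1$ vertices). Suppose one of the components of $G_R$ consists of a single vertex $r$. Then $G_B$ also has an isolated vertex $b$, every red edge joins $b$ to one of the $d-1$ vertices other than $r$ and $b$ (and all such edges are present), and every blue edge joins $r$ to one of the $d-1$ vertices other than $r$ and $b$ (and all such edges are present); that is, $G_Z$ is the complete bipartite graph $K_{2,d-1}$ with parts $\{r,b\}$ and the remaining vertices.
   Context: Let $\mathbf e_1,\dots,\mathbf e_{d+1}$ be the standard basis of $\mathbb R^{d+1}$, $\mathbf e_{ij}=\mathbf e_i-\mathbf e_j$, $V(d)=\{\mathbf e_{ij}:i<j\}$, $Z(V)=\sum_{\mathbf v\in V}[\mathbf 0,\mathbf v]$. The graph of $Z(V)$ has vertices $1,\dots,d+1$ and an edge $\{i,j\}$ iff $\pm\mathbf e_{ij}\in V$; edges from $V_R$ are red, from $V_B$ blue. Two sets $V_1,V_2$ in a $d$-dimensional space, each of $d-1$ vectors spanning a $(d-1)$-dimensional subspace, are conjugate if for all $\mathbf u_1\in V_1,\mathbf u_2\in V_2$ both $\{\mathbf u_1\}\cup V_2$ and $\{\mathbf u_2\}\cup V_1$ span $d$-dimensional spaces; $Z(V_R\cup V_B)$ is symmetric if $V_R,V_B$ are conjugate in the span of $V_R\cup V_B$. Standing assumption: $d\ge 3$. -}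

module Defs where

open import Data.Nat using (ℕ; suc)
open import Data.Fin using (Fin; zero; suc; _<_)
open import Data.Fin.Properties using (_≟_)
open import Data.Rational using (ℚ; 0ℚ; 1ℚ; _+_; _-_; _*_)
open import Data.List using (List; []; _∷_; length)
open import Data.List.Membership.Propositional using (_∈_)
open import Data.List.Relation.Unary.All using (All)
open import Data.Product using (_×_; _,_; Σ-syntax)
open import Data.Sum using (_⊎_)
open import Relation.Binary.PropositionalEquality using (_≡_; _≢_)
open import Relation.Binary.Construct.Closure.ReflexiveTransitive using (Star)
open import Relation.Nullary using (¬_; yes; no)

-- Vectors of ℚ^n (ℚ^{d+1} with n = d+1), as functions.
Vect : ℕ → Set
Vect n = Fin n → ℚ

zeroV : ∀ {n} → Vect n
zeroV _ = 0ℚ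

_+V_ : ∀ {n} → Vect n → Vect n → Vect n
(u +V v) k = u k + v k

_·V_ : ∀ {n} → ℚ → Vect n → Vect n
(c ·V v) k = c * v k

𝐞 : ∀ {n} → Fin n → Vect n
𝐞 i k with k ≟ i
... | yes _ = 1ℚ
... | no  _ = 0ℚ

𝐞₂ : ∀ {n} → Fin n → Fin n → Vect n
𝐞₂ i j k = 𝐞 i k - 𝐞 j k

-- a generator e_{ij} is encoded by the index pair (i , j)
Pair : ℕ → Set
Pair n = Fin n × Fin n

vecOf : ∀ {n} → Pair n → Vect n
vecOf (i , j) = 𝐞₂ i j

lincomb : ∀ {n} (vs : List (Vect n)) → (Fin (length vs) → ℚ) → Vect n
lincomb []       c = zeroV
lincomb (v ∷ vs) c = (c zero ·V v) +V lincomb vs (λ l → c (suc l))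

LinIndep : ∀ {n} → List (Vect n) → Set
LinIndep vs = ∀ (c : Fin (length vs) → ℚ) →
  (∀ k → lincomb vs c k ≡ 0ℚ) → ∀ l → c l ≡ 0ℚ

vecs : ∀ {n} → List (Pair n) → List (Vect n)
vecs []       = []
vecs (p ∷ ps) = vecOf p ∷ vecs ps

-- a list of pairs encodes a subset of V(d): every pair (i , j) has i < j
InV : ∀ {n} → List (Pair n) → Set
InV ps = All (λ p → Data.Product.proj₁ p < Data.Product.proj₂ p) ps
  where import Data.Product

-- "a family of m vectors spans an m-dimensional space", i.e. linear independence
SpansFull : ∀ {n} → List (Pair n) → Set
SpansFull ps = LinIndep (vecs ps)

Conjugate : ℕ → ∀ {n} → List (Pair n) → List (Pair n) → Set
Conjugate d V₁ V₂ =
  length V₁ ≡ d Data.Nat.∸ 1 × length V₂ ≡ d Data.Nat.∸ 1 ×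
  SpansFull V₁ × SpansFull V₂ ×
  (∀ u → u ∈ V₁ → SpansFull (u ∷ V₂)) ×
  (∀ u → u ∈ V₂ → SpansFull (u ∷ V₁))
  where import Data.Nat

-- dim span(V) ≥ m : some m members of V are linearly independent
-- (for V ⊆ V(d) the span lies in the hyperplane Σx=0, so dim ≤ d automatically)
DimAtLeast : ∀ {n} → ℕ → List (Pair n) → Set
DimAtLeast {n} m V = Σ[ W ∈ List (Pair n) ]
  (length W ≡ m × All (λ p → p ∈ V) W × SpansFull W)

-- graph edge {i,j} coloured by a set V of generators: ±e_{ij} ∈ V
Edge : ∀ {n} → List (Pair n) → Fin n → Fin n → Set
Edge V i j = (i , j) ∈ V ⊎ (j , i) ∈ V

EdgeZ : ∀ {n} → List (Pair n) → List (Pair n) → Fin n → Fin n → Set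
EdgeZ VR VB i j = Edge VR i j ⊎ Edge VB i j

Connected : ∀ {n} → (Fin n → Fin n → Set) → Set
Connected E = ∀ i j → Star E i j

Isolated : ∀ {n} → (Fin n → Fin n → Set) → Fin n → Set
Isolated E r = ∀ j → ¬ E r j

module Submission where

-- Everything rests on one rank bound: edge vectors e_ij have coordinate sum 0, so m+1
-- of them whose endpoints all lie in a vertex set F with |F| ≤ m+1 are linearly
-- dependent (the zero-sum vectors supported on F span only |F|-1 dimensions).  Applied to conjugacy:
--   * mustTouch:  d-1 generators avoiding x plus one more are independent only if the
--                 extra generator touches x   (blue edges touch r; red edges touch b);
--   * mustCover:  d-1 independent generators avoiding x cover every other vertex;
--   * noTriangle: a red edge ij with blue edges ir, jr would close a cycle, so one
--                 endpoint b of any red edge is isolated in the blue graph (partner).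

open import Defs
open import Data.Nat using (ℕ; suc; zero; _≤_; _<_; z≤n; s≤s)
import Data.Nat.Properties as ℕ
open import Data.Fin using (Fin; zero; suc; toℕ; fromℕ<)
open import Data.Fin.Properties using (_≟_; toℕ-fromℕ<; any?; suc-injective; <⇒≢)
open import Data.Rational
  using (ℚ; 0ℚ; 1ℚ; _+_; _-_; _*_; -_; 1/_; NonZero; ≢-nonZero)
  renaming (_≟_ to _≟ℚ_)
import Data.Rational.Properties as QP
open import Data.Rational.Solver using (module +-*-Solver)
open +-*-Solver
open import Data.List using (List; []; _∷_; _++_; length; map; filter; allFin)
open import Data.List.Properties using (length-map; length-tabulate; filter-notAll)
open import Data.List.Membership.Propositional using (_∈_; _∉_; find; lose)
open import Data.List.Membership.Propositional.Properties using (∈-filter⁺; ∈-allFin)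
open import Data.List.Relation.Unary.Any using (Any; here; there)
import Data.List.Relation.Unary.Any as Any
open import Data.List.Relation.Unary.All using (All; []; _∷_)
import Data.List.Relation.Unary.All as All
import Data.List.Relation.Unary.All.Properties as AllP
open import Data.Product using (_×_; _,_; Σ-syntax; proj₁; proj₂)
open import Data.Sum using (_⊎_; inj₁; inj₂)
import Data.Sum as Sum
import Data.Product as Prod
open import Data.Empty using (⊥-elim)
open import Function using (id)
open import Function.Bundles using (_⇔_; mk⇔)
import Function.Properties.Equivalence as ⇔
open import Relation.Nullary using (¬_; Dec; yes; no; ¬?)
open import Relation.Nullary.Decidable using (_⊎-dec_; decidable-stable)
open import Relation.Binary.PropositionalEquality

-- Linear combinations with ℕ-indexed coefficients (entries past the end are ignored);
-- this avoids transporting Fin-indices along equalities of lengths.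
lc : ∀ {n} → List (Vect n) → (ℕ → ℚ) → Vect n
lc []       c = zeroV
lc (v ∷ vs) c = (c 0 ·V v) +V lc vs (λ l → c (suc l))

Dependent : ∀ {n} → List (Vect n) → Set
Dependent vs = Σ[ c ∈ (ℕ → ℚ) ]
  ((∀ k → lc vs c k ≡ 0ℚ) × Σ[ l ∈ ℕ ] (l < length vs × c l ≢ 0ℚ))

lincomb≡lc : ∀ {n} (vs : List (Vect n)) (c : ℕ → ℚ) k →
  lincomb vs (λ i → c (toℕ i)) k ≡ lc vs c k
lincomb≡lc []       c k = refl
lincomb≡lc (v ∷ vs) c k = cong (c 0 * v k +_) (lincomb≡lc vs (λ l → c (suc l)) k)

dependent⇒¬LinIndep : ∀ {n} {vs : List (Vect n)} → Dependent vs → ¬ LinIndep vs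
dependent⇒¬LinIndep {vs = vs} (c , vanish , l , l<len , cl≢0) indep =
  cl≢0 (trans (sym (cong c (toℕ-fromℕ< l<len)))
    (indep (λ i → c (toℕ i)) (λ k → trans (lincomb≡lc vs c k) (vanish k)) (fromℕ< l<len)))

_◂_ : ℚ → (ℕ → ℚ) → ℕ → ℚ
(a ◂ c) zero    = a
(a ◂ c) (suc l) = c l

unit : ℕ → ℚ → ℕ → ℚ
unit zero    a zero    = a
unit zero    a (suc l) = 0ℚ
unit (suc p) a zero    = 0ℚ
unit (suc p) a (suc l) = unit p a l

lc-zero : ∀ {n} (vs : List (Vect n)) k → lc vs (λ _ → 0ℚ) k ≡ 0ℚ
lc-zero []       k = refl
lc-zero (v ∷ vs) k rewrite lc-zero vs k | QP.*-zeroˡ (v k) = refl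

lc-+ : ∀ {n} (vs : List (Vect n)) c c′ k →
  lc vs (λ l → c l + c′ l) k ≡ lc vs c k + lc vs c′ k
lc-+ []       c c′ k = refl
lc-+ (v ∷ vs) c c′ k rewrite lc-+ vs (λ l → c (suc l)) (λ l → c′ (suc l)) k =
  solve 5 (λ x y w L L′ → (x :+ y) :* w :+ (L :+ L′) := (x :* w :+ L) :+ (y :* w :+ L′))
    refl (c 0) (c′ 0) (v k) _ _

lc-unit : ∀ {n} {v : Vect n} {vs} → v ∈ vs → Σ[ p ∈ ℕ ] (∀ a k → lc vs (unit p a) k ≡ a * v k)
lc-unit {vs = w ∷ vs} (here refl) =
  0 , λ a k → trans (cong (a * w k +_) (lc-zero vs k)) (QP.+-identityʳ _)
lc-unit {vs = w ∷ vs} (there v∈vs) with lc-unit v∈vs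
... | p , pick = suc p , λ a k → trans (cong₂ _+_ (QP.*-zeroˡ (w k)) (pick a k)) (QP.+-identityˡ _)

zeroHead-dependent : ∀ {n} {v : Vect n} vs → (∀ k → v k ≡ 0ℚ) → Dependent (v ∷ vs)
zeroHead-dependent {v = v} vs v≡0 = (1ℚ ◂ λ _ → 0ℚ) , vanish , 0 , s≤s z≤n , (λ ())
  where
  vanish : ∀ k → 1ℚ * v k + lc vs (λ _ → 0ℚ) k ≡ 0ℚ
  vanish k rewrite v≡0 k | lc-zero vs k = refl

relation-dependent : ∀ {n} {u v₁ v₂ : Vect n} {vs} (a b : ℚ) → v₁ ∈ vs → v₂ ∈ vs →
  (∀ k → u k + (a * v₁ k + b * v₂ k) ≡ 0ℚ) → Dependent (u ∷ vs)
relation-dependent {u = u} {vs = vs} a b v₁∈vs v₂∈vs rel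
  with lc-unit v₁∈vs | lc-unit v₂∈vs
... | p₁ , pick₁ | p₂ , pick₂ =
  (1ℚ ◂ λ l → unit p₁ a l + unit p₂ b l) , vanish , 0 , s≤s z≤n , (λ ())
  where
  vanish : ∀ k → 1ℚ * u k + lc vs (λ l → unit p₁ a l + unit p₂ b l) k ≡ 0ℚ
  vanish k = trans (cong₂ _+_ (QP.*-identityˡ (u k))
    (trans (lc-+ vs (unit p₁ a) (unit p₂ b) k) (cong₂ _+_ (pick₁ a k) (pick₂ b k)))) (rel k)

-- The coordinate sum Σ_k v_k: a linear functional vanishing on every e_ij, which is
-- what confines edge vectors to a hyperplane and bounds their rank.
coordSum : ∀ {n} → Vect n → ℚ
coordSum {zero}  v = 0ℚ
coordSum {suc n} v = v zero + coordSum (λ k → v (suc k))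

coordSum-+ : ∀ {n} (u v : Vect n) → coordSum (u +V v) ≡ coordSum u + coordSum v
coordSum-+ {zero}  u v = refl
coordSum-+ {suc n} u v rewrite coordSum-+ (λ k → u (suc k)) (λ k → v (suc k)) =
  solve 4 (λ a b s t → (a :+ b) :+ (s :+ t) := (a :+ s) :+ (b :+ t)) refl (u zero) (v zero) _ _

coordSum-· : ∀ {n} (c : ℚ) (v : Vect n) → coordSum (c ·V v) ≡ c * coordSum v
coordSum-· {zero}  c v = sym (QP.*-zeroʳ c)
coordSum-· {suc n} c v rewrite coordSum-· c (λ k → v (suc k)) =
  solve 3 (λ c a s → c :* a :+ c :* s := c :* (a :+ s)) refl c (v zero) _

coordSum-- : ∀ {n} (u v : Vect n) → coordSum (λ k → u k - v k) ≡ coordSum u - coordSum v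
coordSum-- {zero}  u v = refl
coordSum-- {suc n} u v rewrite coordSum-- (λ k → u (suc k)) (λ k → v (suc k)) =
  solve 4 (λ a b s t → (a :- b) :+ (s :- t) := (a :+ s) :- (b :+ t)) refl (u zero) (v zero) _ _

coordSum-single : ∀ {n} (v : Vect n) (s : Fin n) → (∀ k → k ≢ s → v k ≡ 0ℚ) → coordSum v ≡ v s
coordSum-single {suc n} v zero rest =
  trans (cong (v zero +_) (allZero (λ k → v (suc k)) (λ k → rest (suc k) (λ ())))) (QP.+-identityʳ _)
  where
  allZero : ∀ {m} (w : Vect m) → (∀ k → w k ≡ 0ℚ) → coordSum w ≡ 0ℚ
  allZero {zero}  w w≡0 = refl
  allZero {suc m} w w≡0 rewrite w≡0 zero | allZero (λ k → w (suc k)) (λ k → w≡0 (suc k)) = refl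
coordSum-single {suc n} v (suc s) rest rewrite rest zero (λ ())
  | coordSum-single (λ k → v (suc k)) s (λ k k≢s → rest (suc k) (λ e → k≢s (suc-injective e))) =
  QP.+-identityˡ _

𝐞-on : ∀ {n} (i : Fin n) → 𝐞 i i ≡ 1ℚ
𝐞-on i with i ≟ i
... | yes _ = refl
... | no i≢i = ⊥-elim (i≢i refl)

𝐞-off : ∀ {n} {i k : Fin n} → k ≢ i → 𝐞 i k ≡ 0ℚ
𝐞-off {i = i} {k} k≢i with k ≟ i
... | yes k≡i = ⊥-elim (k≢i k≡i)
... | no _ = refl

coordSum-𝐞 : ∀ {n} (i : Fin n) → coordSum (𝐞 i) ≡ 1ℚ
coordSum-𝐞 i = trans (coordSum-single (𝐞 i) i (λ k → 𝐞-off)) (𝐞-on i)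

coordSum-𝐞₂ : ∀ {n} (i j : Fin n) → coordSum (𝐞₂ i j) ≡ 0ℚ
coordSum-𝐞₂ i j rewrite coordSum-- (𝐞 i) (𝐞 j) | coordSum-𝐞 i | coordSum-𝐞 j = refl

without : ∀ {n} → Fin n → List (Fin n) → List (Fin n)
without s = filter (λ k → ¬? (k ≟ s))

without-shorter : ∀ {n} {s : Fin n} {xs} → s ∈ xs → length (without s xs) < length xs
without-shorter {s = s} {xs} s∈xs =
  filter-notAll (λ k → ¬? (k ≟ s)) xs (Any.map (λ s≡k ¬k≡s → ¬k≡s (sym s≡k)) s∈xs)

∈-without : ∀ {n} {s k : Fin n} {xs} → k ∈ xs → k ≢ s → k ∈ without s xs
∈-without {s = s} k∈xs k≢s = ∈-filter⁺ (λ k → ¬? (k ≟ s)) k∈xs k≢s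

∉-without : ∀ {n} {s k : Fin n} {xs} → k ∉ without s xs → k ≡ s ⊎ k ∉ xs
∉-without {s = s} {k} k∉ with k ≟ s
... | yes k≡s = inj₁ k≡s
... | no k≢s = inj₂ (λ k∈xs → k∉ (∈-without k∈xs k≢s))

∉-short : ∀ {A : Set} {x : A} {xs} → length xs ≤ 0 → x ∉ xs
∉-short () (here _)
∉-short () (there _)

ZeroSumOn : ∀ {n} → List (Fin n) → Vect n → Set
ZeroSumOn F v = (∀ k → k ∉ F → v k ≡ 0ℚ) × coordSum v ≡ 0ℚ

support : ∀ {n} {F : List (Fin n)} {v : Vect n} {s} →
  (∀ k → k ∉ F → v k ≡ 0ℚ) → v s ≢ 0ℚ → s ∈ F
support {F = F} {s = s} vanish vs≢0 with Any.any? (s ≟_) F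
... | yes s∈F = s∈F
... | no s∉F = ⊥-elim (vs≢0 (vanish s s∉F))

module Elimination {n} (v : Vect n) (s : Fin n) {{_ : NonZero (v s)}} where

  factor : Vect n → ℚ
  factor u = u s * 1/ v s

  eliminate : Vect n → Vect n
  eliminate u = u +V ((- factor u) ·V v)

  eliminate-pivot : ∀ u → eliminate u s ≡ 0ℚ
  eliminate-pivot u = begin
    u s + (- (u s * 1/ v s)) * v s
      ≡⟨ solve 3 (λ x w y → x :+ (:- (x :* w)) :* y := x :+ (:- (x :* (w :* y))))
           refl (u s) (1/ v s) (v s) ⟩
    u s + (- (u s * (1/ v s * v s)))
      ≡⟨ cong (λ t → u s + (- (u s * t))) (QP.*-inverseˡ (v s)) ⟩
    u s + (- (u s * 1ℚ))
      ≡⟨ solve 1 (λ x → x :+ (:- (x :* con 1ℚ)) := con 0ℚ) refl (u s) ⟩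
    0ℚ ∎
    where open ≡-Reasoning

  eliminate-zeroSumOn : ∀ {F u} → ZeroSumOn F v → ZeroSumOn F u →
    ZeroSumOn (without s F) (eliminate u)
  eliminate-zeroSumOn {F} {u} (vanishᵥ , sumᵥ) (vanishᵤ , sumᵤ) = vanish , sum
    where
    vanish : ∀ k → k ∉ without s F → eliminate u k ≡ 0ℚ
    vanish k k∉ with ∉-without {s = s} {xs = F} k∉
    ... | inj₁ refl = eliminate-pivot u
    ... | inj₂ k∉F rewrite vanishᵤ k k∉F | vanishᵥ k k∉F =
      solve 1 (λ x → con 0ℚ :+ (:- x) :* con 0ℚ := con 0ℚ) refl (factor u)
    sum : coordSum (eliminate u) ≡ 0ℚ
    sum rewrite coordSum-+ u ((- factor u) ·V v) | coordSum-· (- factor u) v | sumᵤ | sumᵥ =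
      solve 1 (λ x → con 0ℚ :+ (:- x) :* con 0ℚ := con 0ℚ) refl (factor u)

  -- The multiple of v hidden in a combination of eliminated vectors.
  totalFactor : List (Vect n) → (ℕ → ℚ) → ℚ
  totalFactor []       c = 0ℚ
  totalFactor (u ∷ us) c = c 0 * factor u + totalFactor us (λ l → c (suc l))

  lc-eliminate : ∀ us c k → lc (map eliminate us) c k ≡ lc us c k + (- totalFactor us c) * v k
  lc-eliminate []       c k = solve 1 (λ x → con 0ℚ := con 0ℚ :+ (:- con 0ℚ) :* x) refl (v k)
  lc-eliminate (u ∷ us) c k rewrite lc-eliminate us (λ l → c (suc l)) k =
    solve 6 (λ c₀ uk fu vk L t → c₀ :* (uk :+ (:- fu) :* vk) :+ (L :+ (:- t) :* vk)
                := (c₀ :* uk :+ L) :+ (:- (c₀ :* fu :+ t)) :* vk)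
      refl (c 0) (u k) (factor u) (v k) _ _

  lift : ∀ us → Dependent (map eliminate us) → Dependent (v ∷ us)
  lift us (c , vanish , l , l<len , cl≢0) =
    ((- totalFactor us c) ◂ c) ,
    (λ k → trans (QP.+-comm _ (lc us c k)) (trans (sym (lc-eliminate us c k)) (vanish k))) ,
    suc l , s≤s (subst (l <_) (length-map eliminate us) l<len) , cl≢0

-- Rank bound: zero-sum vectors supported on F span at most |F| - 1 dimensions, so
-- m+1 of them are dependent once |F| ≤ m+1.  Gaussian elimination on a pivot of the
-- first vector (pivotStep) reduces to m vectors supported on F minus the pivot.
rankBound : ∀ {n} m (F : List (Fin n)) (vs : List (Vect n)) → length vs ≡ suc m →
  length F ≤ suc m → All (ZeroSumOn F) vs → Dependent vs

pivotStep : ∀ {n} m (F : List (Fin n)) (v : Vect n) (vs : List (Vect n)) (s : Fin n) →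
  v s ≢ 0ℚ → length vs ≡ m → length F ≤ suc m →
  ZeroSumOn F v → All (ZeroSumOn F) vs → Dependent (v ∷ vs)

rankBound m F (v ∷ vs) len lenF (zv ∷ zvs) with any? (λ k → ¬? (v k ≟ℚ 0ℚ))
... | yes (s , vs≢0) = pivotStep m F v vs s vs≢0 (ℕ.suc-injective len) lenF zv zvs
... | no noPivot =
  zeroHead-dependent vs (λ k → decidable-stable (v k ≟ℚ 0ℚ) (λ vk≢0 → noPivot (k , vk≢0)))

-- With |F| ≤ 1 the support of v is {s}, so its coordinate sum v s cannot vanish.
pivotStep zero F v vs s vs≢0 len lenF (vanish , sum) zvs =
  ⊥-elim (vs≢0 (trans (sym (coordSum-single v s concentrated)) sum))
  where
  noOther : length (without s F) ≤ 0
  noOther = ℕ.≤-pred (ℕ.≤-trans (without-shorter (support vanish vs≢0)) lenF)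
  concentrated : ∀ k → k ≢ s → v k ≡ 0ℚ
  concentrated k k≢s = vanish k (λ k∈F → ∉-short noOther (∈-without k∈F k≢s))
pivotStep (suc m) F v vs s vs≢0 len lenF zv zvs =
  lift vs (rankBound m (without s F) (map eliminate vs)
    (trans (length-map eliminate vs) len) shorter
    (AllP.map⁺ (All.map (eliminate-zeroSumOn zv) zvs)))
  where
  open Elimination v s {{≢-nonZero vs≢0}}
  shorter : length (without s F) ≤ suc m
  shorter = ℕ.≤-pred (ℕ.≤-trans (without-shorter (support (proj₁ zv) vs≢0)) lenF)

EndpointsIn : ∀ {n} → List (Fin n) → Pair n → Set
EndpointsIn F p = proj₁ p ∈ F × proj₂ p ∈ F

edge-zeroSumOn : ∀ {n} {F : List (Fin n)} (p : Pair n) → EndpointsIn F p → ZeroSumOn F (vecOf p)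
edge-zeroSumOn {F = F} (i , j) (i∈F , j∈F) = vanish , coordSum-𝐞₂ i j
  where
  vanish : ∀ k → k ∉ F → 𝐞₂ i j k ≡ 0ℚ
  vanish k k∉F rewrite 𝐞-off {i = i} {k} (λ { refl → k∉F i∈F })
                     | 𝐞-off {i = j} {k} (λ { refl → k∉F j∈F }) = refl

length-vecs : ∀ {n} (ps : List (Pair n)) → length (vecs ps) ≡ length ps
length-vecs []       = refl
length-vecs (p ∷ ps) = cong suc (length-vecs ps)

vecs-zeroSumOn : ∀ {n} {F : List (Fin n)} {ps} → All (EndpointsIn F) ps → All (ZeroSumOn F) (vecs ps)
vecs-zeroSumOn []                      = []
vecs-zeroSumOn {ps = p ∷ _} (inF ∷ inFs) = edge-zeroSumOn p inF ∷ vecs-zeroSumOn inFs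

vecs-∈ : ∀ {n} {p : Pair n} {ps} → p ∈ ps → vecOf p ∈ vecs ps
vecs-∈ (here refl)  = here refl
vecs-∈ (there p∈ps) = there (vecs-∈ p∈ps)

crowded : ∀ {n} m (F : List (Fin n)) (ps : List (Pair n)) → length ps ≡ suc m →
  length F ≤ suc m → All (EndpointsIn F) ps → ¬ SpansFull ps
crowded m F ps len lenF inF = dependent⇒¬LinIndep {vs = vecs ps}
  (rankBound m F (vecs ps) (trans (length-vecs ps) len) lenF (vecs-zeroSumOn inF))

Touches : ∀ {n} → Pair n → Fin n → Set
Touches p x = proj₁ p ≡ x ⊎ proj₂ p ≡ x

Avoids : ∀ {n} → Pair n → Fin n → Set
Avoids p x = ¬ Touches p x

Covered : ∀ {n} → List (Pair n) → Fin n → Set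
Covered V x = Any (λ p → Touches p x) V

touches? : ∀ {n} (p : Pair n) x → Dec (Touches p x)
touches? p x = (proj₁ p ≟ x) ⊎-dec (proj₂ p ≟ x)

covered? : ∀ {n} (V : List (Pair n)) x → Dec (Covered V x)
covered? V x = Any.any? (λ p → touches? p x) V

isolated⇒avoids : ∀ {n} {V : List (Pair n)} {x} → Isolated (Edge V) x →
  ∀ {p} → p ∈ V → Avoids p x
isolated⇒avoids iso {i , j} p∈V (inj₁ refl) = iso j (inj₁ p∈V)
isolated⇒avoids iso {i , j} p∈V (inj₂ refl) = iso i (inj₂ p∈V)

uncovered⇒avoids : ∀ {n} {V : List (Pair n)} {x} → ¬ Covered V x → ∀ {p} → p ∈ V → Avoids p x
uncovered⇒avoids uncovered p∈V touch = uncovered (lose p∈V touch)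

uncovered⇒isolated : ∀ {n} {V : List (Pair n)} {x} → ¬ Covered V x → Isolated (Edge V) x
uncovered⇒isolated uncovered j (inj₁ p∈V) = uncovered⇒avoids uncovered p∈V (inj₁ refl)
uncovered⇒isolated uncovered j (inj₂ p∈V) = uncovered⇒avoids uncovered p∈V (inj₂ refl)

others : ∀ {n} → Fin (suc n) → List (Fin (suc n))
others {n} x = without x (allFin (suc n))

length-others : ∀ {n} (x : Fin (suc n)) → length (others x) ≤ n
length-others {n} x =
  ℕ.≤-pred (ℕ.≤-trans (without-shorter (∈-allFin x)) (ℕ.≤-reflexive (length-tabulate {n = suc n} id)))

length-others₂ : ∀ {n} {x y : Fin (suc n)} → y ≢ x → length (without y (others x)) < n
length-others₂ {x = x} y≢x =
  ℕ.≤-trans (without-shorter (∈-without (∈-allFin _) y≢x)) (length-others x)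

avoids⇒in-others : ∀ {n} {p : Pair (suc n)} {x} → Avoids p x → EndpointsIn (others x) p
avoids⇒in-others avoid =
  ∈-without (∈-allFin _) (λ e → avoid (inj₁ e)) , ∈-without (∈-allFin _) (λ e → avoid (inj₂ e))

avoids₂⇒in-others : ∀ {n} {p : Pair (suc n)} {x y} → Avoids p x → Avoids p y →
  EndpointsIn (without y (others x)) p
avoids₂⇒in-others avoidˣ avoidʸ with avoids⇒in-others avoidˣ
... | i∈ , j∈ = ∈-without i∈ (λ e → avoidʸ (inj₁ e)) , ∈-without j∈ (λ e → avoidʸ (inj₂ e))

-- If the d-1 generators A avoid x and u ∷ A is independent, then u touches x:
-- otherwise d generators would live on the d vertices other than x.
mustTouch : ∀ {m} (x : Fin (suc (suc m))) (A : List (Pair (suc (suc m)))) →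
  length A ≡ m → (∀ {p} → p ∈ A → Avoids p x) → ∀ u → SpansFull (u ∷ A) → Touches u x
mustTouch {m} x A len avoid u indep with touches? u x
... | yes touch = touch
... | no miss = ⊥-elim (crowded m (others x) (u ∷ A) (cong suc len) (length-others x)
  (avoids⇒in-others miss ∷ All.tabulate (λ p∈A → avoids⇒in-others (avoid p∈A))) indep)

-- d-1 independent generators avoiding x cover every other vertex y:
-- otherwise they would live on the d-1 vertices other than x and y.
mustCover : ∀ {m} (x : Fin (suc (suc (suc m)))) (A : List (Pair (suc (suc (suc m))))) →
  length A ≡ suc m → (∀ {p} → p ∈ A → Avoids p x) → SpansFull A →
  ∀ {y} → y ≢ x → Covered A y
mustCover {m} x A len avoid indep {y} y≢x with covered? A y
... | yes cover = cover
... | no uncovered = ⊥-elim (crowded m (without y (others x)) A len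
  (ℕ.≤-pred (length-others₂ y≢x))
  (All.tabulate (λ p∈A → avoids₂⇒in-others (avoid p∈A) (uncovered⇒avoids uncovered p∈A)))
  indep)

sideVector : ∀ {n} {q : Pair n} {i r} → Touches q i → Touches q r → i ≢ r →
  Σ[ σ ∈ ℚ ] (∀ k → σ * vecOf q k ≡ 𝐞 r k - 𝐞 i k)
sideVector (inj₁ refl) (inj₁ refl) i≢r = ⊥-elim (i≢r refl)
sideVector {q = i , r} (inj₁ refl) (inj₂ refl) i≢r =
  - 1ℚ , λ k → solve 2 (λ a b → (:- con 1ℚ) :* (a :- b) := b :- a) refl (𝐞 i k) (𝐞 r k)
sideVector (inj₂ refl) (inj₁ refl) i≢r = 1ℚ , λ k → QP.*-identityˡ _
sideVector (inj₂ refl) (inj₂ refl) i≢r = ⊥-elim (i≢r refl)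

-- Generators q₁, q₂ ∈ B joining i and j to a third vertex r close a triangle:
-- e_ij = (e_r - e_j) - (e_r - e_i) lies in the span of B.
noTriangle : ∀ {n} {B : List (Pair n)} {i j r q₁ q₂} → i ≢ r → j ≢ r →
  q₁ ∈ B → Touches q₁ i → Touches q₁ r → q₂ ∈ B → Touches q₂ j → Touches q₂ r →
  ¬ SpansFull ((i , j) ∷ B)
noTriangle {B = B} {i} {j} {r} {q₁} {q₂} i≢r j≢r q₁∈B q₁i q₁r q₂∈B q₂j q₂r
  with sideVector q₁i q₁r i≢r | sideVector q₂j q₂r j≢r
... | σ₁ , side₁ | σ₂ , side₂ = dependent⇒¬LinIndep {vs = vecs ((i , j) ∷ B)}
  (relation-dependent σ₁ (- σ₂) (vecs-∈ q₁∈B) (vecs-∈ q₂∈B) closes)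
  where
  open ≡-Reasoning
  closes : ∀ k → 𝐞₂ i j k + (σ₁ * vecOf q₁ k + (- σ₂) * vecOf q₂ k) ≡ 0ℚ
  closes k = begin
    𝐞₂ i j k + (σ₁ * vecOf q₁ k + (- σ₂) * vecOf q₂ k)
      ≡⟨ cong (λ t → 𝐞₂ i j k + (σ₁ * vecOf q₁ k + t))
           (solve 2 (λ s x → (:- s) :* x := :- (s :* x)) refl σ₂ (vecOf q₂ k)) ⟩
    𝐞₂ i j k + (σ₁ * vecOf q₁ k + - (σ₂ * vecOf q₂ k))
      ≡⟨ cong₂ (λ t t′ → 𝐞₂ i j k + (t + - t′)) (side₁ k) (side₂ k) ⟩
    (𝐞 i k - 𝐞 j k) + ((𝐞 r k - 𝐞 i k) + - (𝐞 r k - 𝐞 j k))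
      ≡⟨ solve 3 (λ a b c → (a :- b) :+ ((c :- a) :+ (:- (c :- b))) := con 0ℚ)
           refl (𝐞 i k) (𝐞 j k) (𝐞 r k) ⟩
    0ℚ ∎

-- If every generator of B touches r and an edge ij avoiding r extends B independently,
-- then i or j is isolated in B: were both covered, the covering edges close a triangle.
partner : ∀ {n} {r : Fin n} {B : List (Pair n)} (i j : Fin n) → Avoids (i , j) r →
  (∀ {q} → q ∈ B → Touches q r) → SpansFull ((i , j) ∷ B) →
  Σ[ b ∈ Fin n ] (b ≢ r × Isolated (Edge B) b)
partner {B = B} i j avoid touchR indep with covered? B i | covered? B j
... | no uncoveredᵢ | _ = i , (λ e → avoid (inj₁ e)) , uncovered⇒isolated uncoveredᵢ
... | yes _ | no uncoveredⱼ = j , (λ e → avoid (inj₂ e)) , uncovered⇒isolated uncoveredⱼ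
... | yes coverᵢ | yes coverⱼ with find coverᵢ | find coverⱼ
...   | q₁ , q₁∈B , q₁i | q₂ , q₂∈B , q₂j = ⊥-elim (noTriangle (λ e → avoid (inj₁ e))
  (λ e → avoid (inj₂ e)) q₁∈B q₁i (touchR q₁∈B) q₂∈B q₂j (touchR q₂∈B) indep)

starEdges : ∀ {n} {V : List (Pair n)} {x y} → InV V →
  (∀ {p} → p ∈ V → Touches p x) → (∀ {p} → p ∈ V → Avoids p y) →
  (∀ {j} → j ≢ y → Covered V j) →
  ∀ i j → Edge V i j ⇔ ((i ≡ x × j ≢ x × j ≢ y) ⊎ (j ≡ x × i ≢ x × i ≢ y))
starEdges {V = V} {x} {y} inV touch avoid cover i j = mk⇔ forward backward
  where
  loopless : ∀ {a c} → (a , c) ∈ V → a ≢ c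
  loopless p∈V = <⇒≢ (All.lookup inV p∈V)

  spoke : ∀ {a c} → (a , c) ∈ V → (a ≡ x × c ≢ x × c ≢ y) ⊎ (c ≡ x × a ≢ x × a ≢ y)
  spoke p∈V with touch p∈V
  ... | inj₁ refl = inj₁ (refl , (λ { refl → loopless p∈V refl }) , λ e → avoid p∈V (inj₂ e))
  ... | inj₂ refl = inj₂ (refl , (λ { refl → loopless p∈V refl }) , λ e → avoid p∈V (inj₁ e))

  toCentre : ∀ {c} → c ≢ x → c ≢ y → Edge V x c
  toCentre c≢x c≢y with find (cover c≢y)
  ... | _ , p∈V , touchᶜ with touchᶜ | touch p∈V
  ...   | inj₁ refl | inj₁ refl = ⊥-elim (c≢x refl)
  ...   | inj₁ refl | inj₂ refl = inj₂ p∈V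
  ...   | inj₂ refl | inj₁ refl = inj₁ p∈V
  ...   | inj₂ refl | inj₂ refl = ⊥-elim (c≢x refl)

  forward : Edge V i j → (i ≡ x × j ≢ x × j ≢ y) ⊎ (j ≡ x × i ≢ x × i ≢ y)
  forward (inj₁ p∈V) = spoke p∈V
  forward (inj₂ p∈V) = Sum.swap (spoke p∈V)

  backward : (i ≡ x × j ≢ x × j ≢ y) ⊎ (j ≡ x × i ≢ x × i ≢ y) → Edge V i j
  backward (inj₁ (refl , j≢x , j≢y)) = toCentre j≢x j≢y
  backward (inj₂ (refl , i≢x , i≢y)) = Sum.swap (toCentre i≢x i≢y)

swapExclusions : ∀ {A B C D E F : Set} → (A × B × C) ⊎ (D × E × F) → (A × C × B) ⊎ (D × F × E)
swapExclusions = Sum.map (Prod.map₂ Prod.swap) (Prod.map₂ Prod.swap)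

mainTheorem14 : (d : ℕ) → 3 ≤ d →
    (VR VB : List (Pair (suc d))) → InV VR → InV VB →
    DimAtLeast d (VR ++ VB) →
    Conjugate d VR VB →
    Connected (EdgeZ VR VB) →
    (r : Fin (suc d)) → Isolated (Edge VR) r →
    Σ[ b ∈ Fin (suc d) ] (b ≢ r × Isolated (Edge VB) b ×
      (∀ i j → Edge VR i j ⇔ ((i ≡ b × j ≢ r × j ≢ b) ⊎ (j ≡ b × i ≢ r × i ≢ b))) ×
      (∀ i j → Edge VB i j ⇔ ((i ≡ r × j ≢ r × j ≢ b) ⊎ (j ≡ r × i ≢ r × i ≢ b))))
mainTheorem14 (suc (suc (suc _))) (s≤s (s≤s (s≤s z≤n))) [] _ _ _ _ (() , _) _ _ _
mainTheorem14 (suc (suc (suc _))) (s≤s (s≤s (s≤s z≤n))) VR@((i , j) ∷ _) VB inVR inVB _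
  (lenR , lenB , indepR , indepB , conjR , conjB) _ r isoR =
  b , b≢r , isoB , redStar , blueStar
  where
  redAvoidsR : ∀ {p} → p ∈ VR → Avoids p r
  redAvoidsR = isolated⇒avoids isoR

  blueTouchesR : ∀ {p} → p ∈ VB → Touches p r
  blueTouchesR {p} p∈VB = mustTouch r VR lenR redAvoidsR p (conjB p p∈VB)

  partnerOfR : Σ[ b ∈ Fin _ ] (b ≢ r × Isolated (Edge VB) b)
  partnerOfR = partner i j (redAvoidsR (here refl)) blueTouchesR (conjR (i , j) (here refl))

  b : Fin _
  b = proj₁ partnerOfR
  b≢r : b ≢ r
  b≢r = proj₁ (proj₂ partnerOfR)
  isoB : Isolated (Edge VB) b
  isoB = proj₂ (proj₂ partnerOfR)

  blueAvoidsB : ∀ {p} → p ∈ VB → Avoids p b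
  blueAvoidsB = isolated⇒avoids isoB

  redTouchesB : ∀ {p} → p ∈ VR → Touches p b
  redTouchesB {p} p∈VR = mustTouch b VB lenB blueAvoidsB p (conjR p p∈VR)

  redStar : ∀ i j → Edge VR i j ⇔ ((i ≡ b × j ≢ r × j ≢ b) ⊎ (j ≡ b × i ≢ r × i ≢ b))
  redStar i j = ⇔.trans (starEdges {x = b} {y = r} inVR redTouchesB redAvoidsR
    (mustCover r VR lenR redAvoidsR indepR) i j) (mk⇔ swapExclusions swapExclusions)

  blueStar : ∀ i j → Edge VB i j ⇔ ((i ≡ r × j ≢ r × j ≢ b) ⊎ (j ≡ r × i ≢ r × i ≢ b))
  blueStar = starEdges {x = r} {y = b} inVB blueTouchesR blueAvoidsB
    (mustCover b VB lenB blueAvoidsB indepB)
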